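{- Let $n\ge 3$ be odd and put $k=(n-1)/2$. In the canonical edge-coloring of the bishop graph $B_{n,n}$ (as defined in the context, with $m=n$), the least frequently used color appears on exactly one edge.
   Context: For integers $1\le m\le n$, the bishop graph $B_{m,n}$ has vertex set $\{(x,y): 1\le x\le n,\ 1\le y\le m\}$ (column $x$, row $y$), with $(x_1,y_1)$ adjacent to $(x_2,y_2)$ iff $|x_1-x_2|=|y_1-y_2|\ge 1$. The length of such an edge is $|x_1-x_2|$; its slope is positive if $(x_1-x_2)(y_1-y_2)>0$ and negative otherwise. Let $m=2k+1$ be odd. For $1\le i\le k$, let $G_i^+$ be the spanning subgraph consisting of all edges of negative slope and length $i$ together with all edges of positive slope and length $m-i$, and let $G_i^-$ consist of all edges of positive slope and length $i$ together with all edges of negative slope and length $m-i$. These $2k$ subgraphs partition the edge set of $B_{m,n}$, and each is a vertex-disjoint union of paths whose edges, listed along the path, move strictly to the right (so each path has a well-defined leftmost edge). The canonical edge-coloring of $B_{m,n}$ assigns to the $2k$ subgraphs pairwise disjoint ordered pairs (first color, second color) of colors from $\{1,\dots,2m-2\}$, with $G_k^-$ receiving first color $2m-3$ and second color $2m-2$, and colors the edges of each path of each subgraph alternately with that subgraph's two colors, the first color being used on the leftmost edge of the path. -}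

module Defs where

open import Data.Nat using (ℕ; zero; suc; _+_; _*_; _∸_; _≤_; _<_; _≡ᵇ_; _<ᵇ_)
open import Data.Nat.Base using (_≤ᵇ_)
open import Data.Bool using (Bool; true; false; _∧_; _∨_; if_then_else_; not)
open import Data.List using (List; []; _∷_; map; concatMap; length; upTo; filterᵇ)
open import Data.Nat.ListAction using (sum)
open import Data.Bool.ListAction using (any)
open import Data.Maybe using (Maybe; just; nothing)
open import Data.Product using (_×_; _,_; proj₁; proj₂)
open import Relation.Binary.PropositionalEquality using (_≡_; _≢_)

data Slope : Set where
  pos neg : Slope

data Sign : Set where
  plus minus : Sign

-- An edge of the bishop graph, recorded by its left endpoint (x , y) (column x, row y),
-- its length d and its slope.  Its right endpoint is (x + d , y + d) if the slope is
-- positive and (x + d , y - d) if it is negative.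
record Edge : Set where
  constructor edge
  field
    ex ey ed : ℕ
    es : Slope
open Edge public

range1 : ℕ → List ℕ
range1 n = map suc (upTo n)

validᵇ : ℕ → ℕ → Edge → Bool
validᵇ m n (edge x y d pos) =
  (1 ≤ᵇ x) ∧ (x + d ≤ᵇ n) ∧ (1 ≤ᵇ y) ∧ (y + d ≤ᵇ m) ∧ (1 ≤ᵇ d)
validᵇ m n (edge x y d neg) =
  (1 ≤ᵇ x) ∧ (x + d ≤ᵇ n) ∧ (d <ᵇ y) ∧ (y ≤ᵇ m) ∧ (1 ≤ᵇ d)

allEdges : ℕ → ℕ → List Edge
allEdges m n =
  filterᵇ (validᵇ m n)
    (concatMap (λ x → concatMap (λ y → concatMap (λ d →
        edge x y d pos ∷ edge x y d neg ∷ []) (range1 n)) (range1 m)) (range1 n))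

types : ℕ → Sign → ℕ → List (ℕ × Slope)
types m plus  i = (i , neg) ∷ (m ∸ i , pos) ∷ []
types m minus i = (i , pos) ∷ (m ∸ i , neg) ∷ []

slopeEqᵇ : Slope → Slope → Bool
slopeEqᵇ pos pos = true
slopeEqᵇ neg neg = true
slopeEqᵇ _ _ = false

inGᵇ : ℕ → Sign → ℕ → Edge → Bool
inGᵇ m σ i e = any (λ t → (proj₁ t ≡ᵇ ed e) ∧ slopeEqᵇ (proj₂ t) (es e)) (types m σ i)

leftVia : ℕ → ℕ → ℕ → ℕ × Slope → Maybe (ℕ × ℕ)
leftVia m x y (d , pos) = if (1 ≤ᵇ d) ∧ (d <ᵇ x) ∧ (d <ᵇ y) then just (x ∸ d , y ∸ d) else nothing
leftVia m x y (d , neg) = if (1 ≤ᵇ d) ∧ (d <ᵇ x) ∧ (y + d ≤ᵇ m) then just (x ∸ d , y + d) else nothing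

firstJust : {A : Set} → List (Maybe A) → Maybe A
firstJust [] = nothing
firstJust (just a ∷ _) = just a
firstJust (nothing ∷ r) = firstJust r

-- the left neighbour of vertex (x , y) along its path in G_i^σ (at most one exists)
leftNeighbour : ℕ → Sign → ℕ → ℕ → ℕ → Maybe (ℕ × ℕ)
leftNeighbour m σ i x y = firstJust (map (leftVia m x y) (types m σ i))

-- number of edges of the path of G_i^σ lying to the left of vertex (x , y)
-- (the fuel argument bounds the number of steps; fuel x suffices since x strictly decreases)
depth : ℕ → ℕ → Sign → ℕ → ℕ → ℕ → ℕ
depth zero m σ i x y = 0
depth (suc f) m σ i x y with leftNeighbour m σ i x y
... | nothing = 0
... | just (x' , y') = suc (depth f m σ i x' y')

-- 0-based position of edge e along its path in G_i^σ (0 = leftmost edge)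
position : ℕ → Sign → ℕ → Edge → ℕ
position m σ i e = depth (ex e) m σ i (ex e) (ey e)

evenᵇ : ℕ → Bool
evenᵇ zero = true
evenᵇ (suc n) = not (evenᵇ n)

Assignment : Set
Assignment = Sign → ℕ → ℕ × ℕ

colourIn : Assignment → ℕ → Sign → ℕ → Edge → ℕ
colourIn A m σ i e =
  if evenᵇ (position m σ i e) then proj₁ (A σ i) else proj₂ (A σ i)

-- number of edges of B_{m,n}, m = 2k+1, receiving colour c in the canonical colouring given by A
-- (the 2k subgraphs G_i^σ, 1 ≤ i ≤ k, partition the edge set)
colourCount : Assignment → ℕ → ℕ → ℕ → ℕ
colourCount A k n c =
  sum (concatMap (λ σ → map (λ i →
        length (filterᵇ (λ e → inGᵇ m σ i e ∧ (colourIn A m σ i e ≡ᵇ c)) (allEdges m n)))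
      (range1 k)) (plus ∷ minus ∷ []))
  where m = suc (2 * k)

record CanonicalAssignment (k : ℕ) (A : Assignment) : Set where
  field
    inRange₁ : ∀ σ i → 1 ≤ i → i ≤ k → 1 ≤ proj₁ (A σ i) × proj₁ (A σ i) ≤ 2 * suc (2 * k) ∸ 2
    inRange₂ : ∀ σ i → 1 ≤ i → i ≤ k → 1 ≤ proj₂ (A σ i) × proj₂ (A σ i) ≤ 2 * suc (2 * k) ∸ 2
    distinctInPair : ∀ σ i → 1 ≤ i → i ≤ k → proj₁ (A σ i) ≢ proj₂ (A σ i)
    disjoint : ∀ σ τ i j → 1 ≤ i → i ≤ k → 1 ≤ j → j ≤ k → (σ , i) ≢ (τ , j) →
      (proj₁ (A σ i) ≢ proj₁ (A τ j)) × (proj₁ (A σ i) ≢ proj₂ (A τ j)) ×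
      (proj₂ (A σ i) ≢ proj₁ (A τ j)) × (proj₂ (A σ i) ≢ proj₂ (A τ j))
    lastPair : A minus k ≡ (2 * suc (2 * k) ∸ 3 , 2 * suc (2 * k) ∸ 2)

-- Colours come in pairs, one pair per path system G_i^σ, and along every path the two colours
-- of its pair alternate.  Each G_i^σ has an edge starting in the first column (so leftmost on
-- its path) and the diagonal edge starting at (i+1, i+1), which is second on its path; hence
-- both colours of every pair are used, and the 4k pairwise distinct pair colours exhaust the
-- palette {1, …, 4k}.  The last colour 4k is the second colour of G_k^-, whose edges are the
-- positive edges of length k and the negative edges of length k+1 on the (2k+1)×(2k+1) board;
-- the only one of them that is not leftmost on its path is (k+1, k+1)–(2k+1, 2k+1).
module Submission where

open import Defs
open import Data.Bool using (Bool; true; false; T; if_then_else_; _∧_)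
open import Data.Bool.Properties using (T-∧)
open import Data.Empty using (⊥; ⊥-elim)
open import Data.Fin using (Fin; toℕ; fromℕ<; punchOut; combine; remQuot)
open import Data.Fin.Patterns using (0F; 1F; 2F; 3F)
import Data.Fin.Properties as Fin
open import Data.List using (List; []; _∷_; _++_; map; concatMap; length; filterᵇ)
open import Data.List.Properties using (filter-none; ++-identityʳ)
open import Data.List.Membership.Propositional using (_∈_)
open import Data.List.Membership.Propositional.Properties using (∈-map⁺; ∈-map⁻; ∈-upTo⁺; ∈-upTo⁻; ∈-concat⁺′; ∈-concatMap⁻; ∈-filter⁺; ∈-filter⁻)
open import Data.List.Relation.Binary.Disjoint.Propositional using (Disjoint)
open import Data.List.Relation.Unary.All as All using (All; []; _∷_)
import Data.List.Relation.Unary.All.Properties as All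
open import Data.List.Relation.Unary.AllPairs using ([]; _∷_)
open import Data.List.Relation.Unary.Any as Any using (here; there)
open import Data.List.Relation.Unary.Any.Properties using (any⁺; any⁻)
open import Data.List.Relation.Unary.Unique.Propositional using (Unique)
import Data.List.Relation.Unary.Unique.Propositional.Properties as Unique
open import Data.Maybe using (just; nothing)
open import Data.Nat using (ℕ; zero; suc; _+_; _*_; _∸_; _≤_; _<_; _≡ᵇ_; _≤ᵇ_; _<ᵇ_; s≤s; z≤n)
open import Data.Nat.ListAction using (sum)
open import Data.Nat.ListAction.Properties using (sum-++)
open import Data.Nat.Properties
open import Data.Product using (Σ; ∃; _×_; _,_; proj₁; proj₂; uncurry)
open import Data.Product.Properties using (≡-dec)
open import Data.Sum using (_⊎_; inj₁; inj₂; map₂)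
open import Function using (_∘_)
open import Function.Bundles using (module Equivalence)
open import Function.Definitions using (Injective)
open import Relation.Binary.PropositionalEquality
open import Relation.Nullary using (Dec; yes; no; ¬_; contradiction)
open import Relation.Nullary.Decidable using (T?)

infixr 4 _∧ᵀ_

_∧ᵀ_ : ∀ {a b} → T a → T b → T (a ∧ b)
p ∧ᵀ q = Equivalence.from T-∧ (p , q)

∧ᵀ-proj : ∀ a {b} → T (a ∧ b) → T a × T b
∧ᵀ-proj _ = Equivalence.to T-∧

∈⇒≤sum : ∀ {n ns} → n ∈ ns → n ≤ sum ns
∈⇒≤sum {ns = n ∷ _} (here refl) = m≤m+n n _
∈⇒≤sum {ns = m ∷ _} (there n∈ns) = ≤-trans (∈⇒≤sum n∈ns) (m≤n+m _ m)

sum-map-≡0 : ∀ {A : Set} (f : A → ℕ) xs → (∀ {x} → x ∈ xs → f x ≡ 0) → sum (map f xs) ≡ 0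
sum-map-≡0 f [] _ = refl
sum-map-≡0 f (x ∷ xs) f≡0 = cong₂ _+_ (f≡0 (here refl)) (sum-map-≡0 f xs (f≡0 ∘ there))

sum-map-single : ∀ {A : Set} (f : A → ℕ) {a xs} → Unique xs → a ∈ xs →
                 (∀ {x} → x ∈ xs → x ≢ a → f x ≡ 0) → sum (map f xs) ≡ f a
sum-map-single f {xs = x ∷ xs} (x≢xs ∷ _) (here refl) f≡0 =
  trans (cong (f x +_) (sum-map-≡0 f xs (λ y∈xs → f≡0 (there y∈xs) (All.lookup x≢xs y∈xs ∘ sym))))
        (+-identityʳ (f x))
sum-map-single f {xs = x ∷ xs} (x≢xs ∷ u) (there a∈xs) f≡0 =
  trans (cong (_+ sum (map f xs)) (f≡0 (here refl) (All.lookup x≢xs a∈xs)))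
        (sum-map-single f u a∈xs (λ y∈xs → f≡0 (there y∈xs)))

All-concatMap⁺ : ∀ {A B : Set} {P : B → Set} {g : A → List B} →
                 (∀ x → All P (g x)) → ∀ xs → All P (concatMap g xs)
All-concatMap⁺ Pg xs = All.concat⁺ (All.map⁺ (All.universal Pg xs))

∈-concatMap⁺′ : ∀ {A B : Set} (g : A → List B) {x xs y} → x ∈ xs → y ∈ g x → y ∈ concatMap g xs
∈-concatMap⁺′ g x∈xs y∈gx = ∈-concat⁺′ y∈gx (∈-map⁺ g x∈xs)

concatMap-unique : ∀ {A B : Set} {g : A → List B} (key : B → A) →
                   (∀ x → Unique (g x)) → (∀ x → All (λ y → key y ≡ x) (g x)) →
                   ∀ {xs} → Unique xs → Unique (concatMap g xs)
concatMap-unique key uniq keyed [] = []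
concatMap-unique {g = g} key uniq keyed {x ∷ xs} (x≢xs ∷ u) =
  Unique.++⁺ (uniq x) (concatMap-unique key uniq keyed u) disjoint
  where
  disjoint : Disjoint (g x) (concatMap g xs)
  disjoint (v∈gx , v∈rest) = All.lookup x≢xs x∈xs refl
    where
    x∈xs : x ∈ xs
    x∈xs = Any.map (λ {x′} v∈gx′ → trans (sym (All.lookup (keyed x) v∈gx)) (All.lookup (keyed x′) v∈gx′))
                   (∈-concatMap⁻ g v∈rest)

∈⇒1≤length : ∀ {A : Set} {x : A} {xs} → x ∈ xs → 1 ≤ length xs
∈⇒1≤length {xs = _ ∷ _} _ = s≤s z≤n

1≤length-filterᵇ : ∀ {A : Set} (p : A → Bool) {x xs} → x ∈ xs → T (p x) → 1 ≤ length (filterᵇ p xs)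
1≤length-filterᵇ p x∈xs px = ∈⇒1≤length (∈-filter⁺ (T? ∘ p) x∈xs px)

length-filterᵇ≡0 : ∀ {A : Set} (p : A → Bool) xs → (∀ {x} → x ∈ xs → ¬ T (p x)) → length (filterᵇ p xs) ≡ 0
length-filterᵇ≡0 p xs never = cong length (filter-none (T? ∘ p) (All.tabulate never))

length-filterᵇ≡1 : ∀ {A : Set} (p : A → Bool) {x xs} → Unique xs → x ∈ xs → T (p x) →
                   (∀ {y} → y ∈ xs → T (p y) → y ≡ x) → length (filterᵇ p xs) ≡ 1
length-filterᵇ≡1 p {x} u x∈xs px only =
  constant⇒length≡1 (Unique.filter⁺ (T? ∘ p) u) (∈-filter⁺ (T? ∘ p) x∈xs px)
    (λ y∈ys → uncurry only (∈-filter⁻ (T? ∘ p) y∈ys))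
  where
  constant⇒length≡1 : ∀ {ys} → Unique ys → x ∈ ys → (∀ {y} → y ∈ ys → y ≡ x) → length ys ≡ 1
  constant⇒length≡1 {_ ∷ []} _ _ _ = refl
  constant⇒length≡1 {_ ∷ _ ∷ _} ((y≢z ∷ _) ∷ _) _ ≡x = ⊥-elim (y≢z (trans (≡x (here refl)) (sym (≡x (there (here refl))))))

injective⇒surjective : ∀ {n} {f : Fin n → Fin n} → Injective _≡_ _≡_ f → ∀ y → ∃ λ x → f x ≡ y
injective⇒surjective {suc n} {f} f-inj y with Fin.any? (λ x → f x Fin.≟ y)
... | yes hit = hit
... | no miss = contradiction (Fin.injective⇒≤ g-inj) 1+n≰n
  where
  g : Fin (suc n) → Fin n
  g x = punchOut {i = y} {j = f x} (λ y≡fx → miss (x , sym y≡fx))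
  g-inj : Injective _≡_ _≡_ g
  g-inj eq = f-inj (Fin.punchOut-injective {i = y} _ _ eq)

injective⇒covers : ∀ {n} (f : Fin n → ℕ) → (∀ t → 1 ≤ f t × f t ≤ n) → Injective _≡_ _≡_ f →
                   ∀ c → 1 ≤ c → c ≤ n → ∃ λ t → f t ≡ c
injective⇒covers {n} f bounds f-inj c 1≤c c≤n =
  let t , gt≡ = injective⇒surjective g-inj (index 1≤c c≤n)
  in t , trans (sym (suc-toℕ-index (bounds t))) (trans (cong (suc ∘ toℕ) gt≡) (suc-toℕ-index (1≤c , c≤n)))
  where
  index : ∀ {x} → 1 ≤ x → x ≤ n → Fin n
  index {suc x} _ x<n = fromℕ< x<n

  suc-toℕ-index : ∀ {x} (b : 1 ≤ x × x ≤ n) → suc (toℕ (uncurry index b)) ≡ x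
  suc-toℕ-index {suc x} (_ , x<n) = cong suc (Fin.toℕ-fromℕ< x<n)

  g : Fin n → Fin n
  g t = uncurry index (bounds t)

  g-inj : Injective _≡_ _≡_ g
  g-inj {t} {u} eq = f-inj (trans (sym (suc-toℕ-index (bounds t))) (trans (cong (suc ∘ toℕ) eq) (suc-toℕ-index (bounds u))))

range1-unique : ∀ n → Unique (range1 n)
range1-unique n = Unique.map⁺ suc-injective (Unique.upTo⁺ n)

∈-range1⁺ : ∀ {x n} → 1 ≤ x → x ≤ n → x ∈ range1 n
∈-range1⁺ {suc x} _ x<n = ∈-map⁺ suc (∈-upTo⁺ x<n)

∈-range1⁻ : ∀ {x n} → x ∈ range1 n → 1 ≤ x × x ≤ n
∈-range1⁻ x∈ with ∈-map⁻ suc x∈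
... | _ , j∈ , refl = s≤s z≤n , ∈-upTo⁻ j∈

allEdges-unique : ∀ m n → Unique (allEdges m n)
allEdges-unique m n = Unique.filter⁺ (T? ∘ validᵇ m n)
  (concatMap-unique ex (λ x → concatMap-unique ey (λ y → concatMap-unique ed (λ _ → slopes-unique)
                                                      (λ _ → refl ∷ refl ∷ []) (range1-unique n))
                                                 (λ _ → All-concatMap⁺ (λ _ → refl ∷ refl ∷ []) (range1 n))
                                                 (range1-unique m))
                       (λ _ → All-concatMap⁺ (λ _ → All-concatMap⁺ (λ _ → refl ∷ refl ∷ []) (range1 n)) (range1 m))
                       (range1-unique n))
  where
  slopes-unique : ∀ {x y d} → Unique (edge x y d pos ∷ edge x y d neg ∷ [])
  slopes-unique = ((λ ()) ∷ []) ∷ [] ∷ []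

∈-allEdges⁺ : ∀ {m n x y d s} → 1 ≤ x → x ≤ n → 1 ≤ y → y ≤ m → 1 ≤ d → d ≤ n →
              T (validᵇ m n (edge x y d s)) → edge x y d s ∈ allEdges m n
∈-allEdges⁺ {m} {n} {x} {y} {d} {s} 1≤x x≤n 1≤y y≤m 1≤d d≤n valid =
  ∈-filter⁺ (T? ∘ validᵇ m n)
    (∈-concatMap⁺′ _ (∈-range1⁺ 1≤x x≤n) (∈-concatMap⁺′ _ (∈-range1⁺ 1≤y y≤m) (∈-concatMap⁺′ _ (∈-range1⁺ 1≤d d≤n) (slope∈ s))))
    valid
  where
  slope∈ : ∀ s → edge x y d s ∈ edge x y d pos ∷ edge x y d neg ∷ []
  slope∈ pos = here refl
  slope∈ neg = there (here refl)

∈-allEdges-pos : ∀ {m n x y d} → 1 ≤ x → 1 ≤ y → 1 ≤ d → x + d ≤ n → y + d ≤ m → edge x y d pos ∈ allEdges m n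
∈-allEdges-pos {x = x} {y} 1≤x 1≤y 1≤d x+d≤n y+d≤m =
  ∈-allEdges⁺ 1≤x (m+n≤o⇒m≤o x x+d≤n) 1≤y (m+n≤o⇒m≤o y y+d≤m) 1≤d (m+n≤o⇒n≤o x x+d≤n)
    (≤⇒≤ᵇ 1≤x ∧ᵀ ≤⇒≤ᵇ x+d≤n ∧ᵀ ≤⇒≤ᵇ 1≤y ∧ᵀ ≤⇒≤ᵇ y+d≤m ∧ᵀ ≤⇒≤ᵇ 1≤d)

∈-allEdges-neg : ∀ {m n x y d} → 1 ≤ x → 1 ≤ d → x + d ≤ n → d < y → y ≤ m → edge x y d neg ∈ allEdges m n
∈-allEdges-neg {x = x} 1≤x 1≤d x+d≤n d<y y≤m =
  ∈-allEdges⁺ 1≤x (m+n≤o⇒m≤o x x+d≤n) (≤-trans 1≤d (<⇒≤ d<y)) y≤m 1≤d (m+n≤o⇒n≤o x x+d≤n)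
    (≤⇒≤ᵇ 1≤x ∧ᵀ ≤⇒≤ᵇ x+d≤n ∧ᵀ <⇒<ᵇ d<y ∧ᵀ ≤⇒≤ᵇ y≤m ∧ᵀ ≤⇒≤ᵇ 1≤d)

edgeGrid : ℕ → ℕ → List Edge
edgeGrid m n = concatMap (λ x → concatMap (λ y → concatMap (λ d →
  edge x y d pos ∷ edge x y d neg ∷ []) (range1 n)) (range1 m)) (range1 n)

∈-allEdges⇒validᵇ : ∀ {m n e} → e ∈ allEdges m n → T (validᵇ m n e)
∈-allEdges⇒validᵇ {m} {n} e∈ = proj₂ (∈-filter⁻ (T? ∘ validᵇ m n) {xs = edgeGrid m n} e∈)

validᵇ-pos⁻ : ∀ {m n x y d} → T (validᵇ m n (edge x y d pos)) → x + d ≤ n × y + d ≤ m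
validᵇ-pos⁻ {m} {n} {x} {y} {d} valid =
  let _ , v = ∧ᵀ-proj (1 ≤ᵇ x) valid ; x+d≤n , v = ∧ᵀ-proj (x + d ≤ᵇ n) v
      _ , v = ∧ᵀ-proj (1 ≤ᵇ y) v ; y+d≤m , _ = ∧ᵀ-proj (y + d ≤ᵇ m) v
  in ≤ᵇ⇒≤ (x + d) n x+d≤n , ≤ᵇ⇒≤ (y + d) m y+d≤m

validᵇ-neg⁻ : ∀ {m n x y d} → T (validᵇ m n (edge x y d neg)) → x + d ≤ n
validᵇ-neg⁻ {m} {n} {x} {y} {d} valid = ≤ᵇ⇒≤ (x + d) n (proj₁ (∧ᵀ-proj (x + d ≤ᵇ n) (proj₂ (∧ᵀ-proj (1 ≤ᵇ x) valid))))

slopeEqᵇ⇒≡ : ∀ {s t} → T (slopeEqᵇ s t) → s ≡ t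
slopeEqᵇ⇒≡ {pos} {pos} _ = refl
slopeEqᵇ⇒≡ {neg} {neg} _ = refl

slopeEqᵇ-refl : ∀ s → T (slopeEqᵇ s s)
slopeEqᵇ-refl pos = _
slopeEqᵇ-refl neg = _

inGᵇ⇒type∈ : ∀ m σ i e → T (inGᵇ m σ i e) → (ed e , es e) ∈ types m σ i
inGᵇ⇒type∈ m σ i e inG = Any.map matches (any⁻ _ (types m σ i) inG)
  where
  matches : ∀ {t} → T ((proj₁ t ≡ᵇ ed e) ∧ slopeEqᵇ (proj₂ t) (es e)) → (ed e , es e) ≡ t
  matches {d , s} both = let d≡ , s≡ = ∧ᵀ-proj (d ≡ᵇ ed e) both in cong₂ _,_ (sym (≡ᵇ⇒≡ d (ed e) d≡)) (sym (slopeEqᵇ⇒≡ s≡))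

type∈⇒inGᵇ : ∀ m σ i e → (ed e , es e) ∈ types m σ i → T (inGᵇ m σ i e)
type∈⇒inGᵇ m σ i e t∈ = any⁺ (λ t → (proj₁ t ≡ᵇ ed e) ∧ slopeEqᵇ (proj₂ t) (es e))
  (Any.map (λ { refl → ≡⇒≡ᵇ (ed e) (ed e) refl ∧ᵀ slopeEqᵇ-refl (es e) }) t∈)

shortSlope : Sign → Slope
shortSlope plus = neg
shortSlope minus = pos

inGᵇ-short : ∀ m σ i x y → T (inGᵇ m σ i (edge x y i (shortSlope σ)))
inGᵇ-short m plus i x y = type∈⇒inGᵇ m plus i (edge x y i neg) (here refl)
inGᵇ-short m minus i x y = type∈⇒inGᵇ m minus i (edge x y i pos) (here refl)

firstJust-accept : ∀ {A : Set} {b} {a : A} rest → T b → firstJust ((if b then just a else nothing) ∷ rest) ≡ just a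
firstJust-accept {b = true} _ _ = refl

firstJust-pair⁻ : ∀ {A : Set} b₁ b₂ {a₁ a₂ a : A} →
  firstJust ((if b₁ then just a₁ else nothing) ∷ (if b₂ then just a₂ else nothing) ∷ []) ≡ just a → T b₁ ⊎ T b₂
firstJust-pair⁻ true _ _ = inj₁ _
firstJust-pair⁻ false true _ = inj₂ _

leftVia-firstColumn : ∀ m y t → leftVia m 1 y t ≡ nothing
leftVia-firstColumn m y (zero , pos) = refl
leftVia-firstColumn m y (suc d , pos) = refl
leftVia-firstColumn m y (zero , neg) = refl
leftVia-firstColumn m y (suc d , neg) = refl

leftNeighbour-firstColumn : ∀ m σ i y → leftNeighbour m σ i 1 y ≡ nothing
leftNeighbour-firstColumn m plus i y
  rewrite leftVia-firstColumn m y (i , neg) | leftVia-firstColumn m y (m ∸ i , pos) = refl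
leftNeighbour-firstColumn m minus i y
  rewrite leftVia-firstColumn m y (i , pos) | leftVia-firstColumn m y (m ∸ i , neg) = refl

leftNeighbour-minus : ∀ {m i x y} → 1 ≤ i → i < x → i < y → leftNeighbour m minus i x y ≡ just (x ∸ i , y ∸ i)
leftNeighbour-minus 1≤i i<x i<y = firstJust-accept _ (≤⇒≤ᵇ 1≤i ∧ᵀ <⇒<ᵇ i<x ∧ᵀ <⇒<ᵇ i<y)

leftNeighbour-plus : ∀ {m i x y} → 1 ≤ i → i < x → y + i ≤ m → leftNeighbour m plus i x y ≡ just (x ∸ i , y + i)
leftNeighbour-plus 1≤i i<x y+i≤m = firstJust-accept _ (≤⇒≤ᵇ 1≤i ∧ᵀ <⇒<ᵇ i<x ∧ᵀ ≤⇒≤ᵇ y+i≤m)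

leftNeighbour-minus⁻ : ∀ {m i x y p} → leftNeighbour m minus i x y ≡ just p → (i < x × i < y) ⊎ m ∸ i < x
leftNeighbour-minus⁻ {m} {i} {x} {y} found
  with firstJust-pair⁻ ((1 ≤ᵇ i) ∧ (i <ᵇ x) ∧ (i <ᵇ y)) ((1 ≤ᵇ m ∸ i) ∧ (m ∸ i <ᵇ x) ∧ (y + (m ∸ i) ≤ᵇ m)) found
... | inj₁ short = let _ , i<x∧i<y = ∧ᵀ-proj (1 ≤ᵇ i) short ; i<x , i<y = ∧ᵀ-proj (i <ᵇ x) i<x∧i<y
                   in inj₁ (<ᵇ⇒< i x i<x , <ᵇ⇒< i y i<y)
... | inj₂ long = inj₂ (<ᵇ⇒< (m ∸ i) x (proj₁ (∧ᵀ-proj (m ∸ i <ᵇ x) (proj₂ (∧ᵀ-proj (1 ≤ᵇ m ∸ i) long)))))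

leftNeighbour-diagonal : ∀ {m} σ {i} → 1 ≤ i → suc i + i ≤ m → ∃ λ y → leftNeighbour m σ i (suc i) (suc i) ≡ just (1 , y)
leftNeighbour-diagonal plus {i} 1≤i bound =
  _ , trans (leftNeighbour-plus 1≤i ≤-refl bound) (cong (λ x → just (x , suc i + i)) (m+n∸n≡m 1 i))
leftNeighbour-diagonal minus {i} 1≤i bound =
  _ , trans (leftNeighbour-minus 1≤i ≤-refl ≤-refl) (cong (λ x → just (x , x)) (m+n∸n≡m 1 i))

depth-firstColumn : ∀ f m σ i y → depth f m σ i 1 y ≡ 0
depth-firstColumn zero m σ i y = refl
depth-firstColumn (suc f) m σ i y rewrite leftNeighbour-firstColumn m σ i y = refl

position-firstColumn : ∀ m σ i y d s → position m σ i (edge 1 y d s) ≡ 0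
position-firstColumn m σ i y d s = depth-firstColumn 1 m σ i y

position≡1 : ∀ m σ i {x y y′} d s → leftNeighbour m σ i (suc x) y ≡ just (1 , y′) → position m σ i (edge (suc x) y d s) ≡ 1
position≡1 m σ i {x} {y′ = y′} d s found rewrite found = cong suc (depth-firstColumn x m σ i y′)

oddDepth⇒leftNeighbour : ∀ f m σ i x y → evenᵇ (depth f m σ i x y) ≡ false → ∃ λ p → leftNeighbour m σ i x y ≡ just p
oddDepth⇒leftNeighbour zero m σ i x y ()
oddDepth⇒leftNeighbour (suc f) m σ i x y odd with leftNeighbour m σ i x y
oddDepth⇒leftNeighbour (suc f) m σ i x y odd | just p = p , refl
oddDepth⇒leftNeighbour (suc f) m σ i x y () | nothing

shortEdge-∈ : ∀ {m} σ {i x} → 1 ≤ i → 1 ≤ x → x ≤ suc i → suc i + i ≤ m → edge x (suc i) i (shortSlope σ) ∈ allEdges m m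
shortEdge-∈ plus {i} 1≤i 1≤x x≤1+i bound =
  ∈-allEdges-neg 1≤x 1≤i (≤-trans (+-monoˡ-≤ i x≤1+i) bound) ≤-refl (m+n≤o⇒m≤o (suc i) bound)
shortEdge-∈ minus {i} 1≤i 1≤x x≤1+i bound =
  ∈-allEdges-pos 1≤x (s≤s z≤n) 1≤i (≤-trans (+-monoˡ-≤ i x≤1+i) bound) bound

edgeOfParity : ∀ {m} σ {i} b → 1 ≤ i → suc i + i ≤ m →
  ∃ λ e → e ∈ allEdges m m × T (inGᵇ m σ i e) × evenᵇ (position m σ i e) ≡ b
edgeOfParity {m} σ {i} true 1≤i bound =
  edge 1 (suc i) i (shortSlope σ) , shortEdge-∈ σ 1≤i ≤-refl (s≤s z≤n) bound , inGᵇ-short m σ i 1 (suc i) ,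
  cong evenᵇ (position-firstColumn m σ i (suc i) i (shortSlope σ))
edgeOfParity {m} σ {i} false 1≤i bound =
  let _ , found = leftNeighbour-diagonal σ 1≤i bound in
  edge (suc i) (suc i) i (shortSlope σ) , shortEdge-∈ σ 1≤i (s≤s z≤n) ≤-refl bound , inGᵇ-short m σ i (suc i) (suc i) ,
  cong evenᵇ (position≡1 m σ i i (shortSlope σ) found)

2k+1≡[k+1]+k : ∀ k → suc (2 * k) ≡ suc k + k
2k+1≡[k+1]+k k = cong (λ z → suc (k + z)) (+-identityʳ k)

diagonal-fits : ∀ {i k} → i ≤ k → suc i + i ≤ suc (2 * k)
diagonal-fits {k = k} i≤k = ≤-trans (+-mono-≤ (s≤s i≤k) i≤k) (≤-reflexive (sym (2k+1≡[k+1]+k k)))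

[2k+1]∸k≡k+1 : ∀ k → suc (2 * k) ∸ k ≡ suc k
[2k+1]∸k≡k+1 k = trans (cong (_∸ k) (2k+1≡[k+1]+k k)) (m+n∸n≡m (suc k) k)

x+k≤2k+1⇒x≤k+1 : ∀ {x k} → x + k ≤ suc (2 * k) → x ≤ suc k
x+k≤2k+1⇒x≤k+1 {x} {k} le = +-cancelʳ-≤ k x (suc k) (subst (x + k ≤_) (2k+1≡[k+1]+k k) le)

x+[k+1]≤2k+1⇒x≤k : ∀ {x k} → x + suc k ≤ suc (2 * k) → x ≤ k
x+[k+1]≤2k+1⇒x≤k {x} {k} le = +-cancelʳ-≤ (suc k) x k (subst (x + suc k ≤_) (trans (2k+1≡[k+1]+k k) (+-comm (suc k) k)) le)

leftNeighbour-G⁻k⁻ : ∀ {k x y p} → leftNeighbour (suc (2 * k)) minus k x y ≡ just p → (k < x × k < y) ⊎ suc k < x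
leftNeighbour-G⁻k⁻ {k} {x} = map₂ (subst (_< x) ([2k+1]∸k≡k+1 k)) ∘ leftNeighbour-minus⁻

-- A left neighbour needs column > k, but a short edge of G_k^- must start in column ≤ k+1 and a
-- long one in column ≤ k.
oddEdge-of-G⁻ : ∀ k e → let m = suc (2 * k) in
  T (validᵇ m m e) → T (inGᵇ m minus k e) → evenᵇ (position m minus k e) ≡ false → e ≡ edge (suc k) (suc k) k pos
oddEdge-of-G⁻ k (edge x y d s) valid inG odd
  with inGᵇ⇒type∈ (suc (2 * k)) minus k (edge x y d s) inG | oddDepth⇒leftNeighbour x (suc (2 * k)) minus k x y odd
... | here refl | _ , found = short (validᵇ-pos⁻ {x = x} {y} valid) (leftNeighbour-G⁻k⁻ found)
  where
  short : x + k ≤ suc (2 * k) × y + k ≤ suc (2 * k) → (k < x × k < y) ⊎ suc k < x → edge x y k pos ≡ edge (suc k) (suc k) k pos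
  short (x+k≤m , y+k≤m) (inj₁ (k<x , k<y)) =
    cong₂ (λ a b → edge a b k pos) (≤-antisym (x+k≤2k+1⇒x≤k+1 x+k≤m) k<x) (≤-antisym (x+k≤2k+1⇒x≤k+1 y+k≤m) k<y)
  short (x+k≤m , _) (inj₂ k+1<x) = ⊥-elim (<⇒≱ k+1<x (x+k≤2k+1⇒x≤k+1 x+k≤m))
... | there (here refl) | _ , found = ⊥-elim (long (subst (λ d → x + d ≤ suc (2 * k)) ([2k+1]∸k≡k+1 k) (validᵇ-neg⁻ {x = x} {y} valid))
                                                 (leftNeighbour-G⁻k⁻ found))
  where
  long : x + suc k ≤ suc (2 * k) → (k < x × k < y) ⊎ suc k < x → ⊥
  long x+d≤m (inj₁ (k<x , _)) = <⇒≱ k<x (x+[k+1]≤2k+1⇒x≤k x+d≤m)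
  long x+d≤m (inj₂ k+1<x) = <⇒≱ k+1<x (m≤n⇒m≤1+n (x+[k+1]≤2k+1⇒x≤k x+d≤m))

select : Bool → ℕ × ℕ → ℕ
select b p = if b then proj₁ p else proj₂ p

select≢ : ∀ b {p c} → proj₁ p ≢ c → proj₂ p ≢ c → select b p ≢ c
select≢ true p₁≢c _ = p₁≢c
select≢ false _ p₂≢c = p₂≢c

select-disjoint : ∀ b b′ {p q} → (proj₁ p ≢ proj₁ q) × (proj₁ p ≢ proj₂ q) × (proj₂ p ≢ proj₁ q) × (proj₂ p ≢ proj₂ q) →
                  select b p ≢ select b′ q
select-disjoint true true (ne , _) = ne
select-disjoint true false (_ , ne , _) = ne
select-disjoint false true (_ , _ , ne , _) = ne
select-disjoint false false (_ , _ , _ , ne) = ne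

select-injective : ∀ {b b′} p → proj₁ p ≢ proj₂ p → select b p ≡ select b′ p → b ≡ b′
select-injective {true} {true} _ _ _ = refl
select-injective {true} {false} _ p₁≢p₂ eq = ⊥-elim (p₁≢p₂ eq)
select-injective {false} {true} _ p₁≢p₂ eq = ⊥-elim (p₁≢p₂ (sym eq))
select-injective {false} {false} _ _ _ = refl

colourCountIn : Assignment → ℕ → ℕ → ℕ → Sign → ℕ → ℕ
colourCountIn A k n c σ i =
  length (filterᵇ (λ e → inGᵇ (suc (2 * k)) σ i e ∧ (colourIn A (suc (2 * k)) σ i e ≡ᵇ c)) (allEdges (suc (2 * k)) n))

colourCount-split : ∀ A k n c →
  colourCount A k n c ≡ sum (map (colourCountIn A k n c plus) (range1 k)) + sum (map (colourCountIn A k n c minus) (range1 k))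
colourCount-split A k n c = begin
  colourCount A k n c                      ≡⟨ sum-++ U₊ (U₋ ++ []) ⟩
  sum U₊ + sum (U₋ ++ [])                  ≡⟨ cong (λ us → sum U₊ + sum us) (++-identityʳ U₋) ⟩
  sum U₊ + sum U₋                          ∎
  where
  open ≡-Reasoning
  U₊ = map (colourCountIn A k n c plus) (range1 k)
  U₋ = map (colourCountIn A k n c minus) (range1 k)

colourCountIn≤colourCount : ∀ A k n c σ {i} → 1 ≤ i → i ≤ k → colourCountIn A k n c σ i ≤ colourCount A k n c
colourCountIn≤colourCount A k n c σ {i} 1≤i i≤k = subst (colourCountIn A k n c σ i ≤_) (sym (colourCount-split A k n c)) (inSum σ)
  where
  inPart : ∀ σ → colourCountIn A k n c σ i ≤ sum (map (colourCountIn A k n c σ) (range1 k))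
  inPart σ = ∈⇒≤sum (∈-map⁺ (colourCountIn A k n c σ) (∈-range1⁺ 1≤i i≤k))

  inSum : ∀ σ → colourCountIn A k n c σ i ≤ sum (map (colourCountIn A k n c plus) (range1 k)) + sum (map (colourCountIn A k n c minus) (range1 k))
  inSum plus = ≤-trans (inPart plus) (m≤m+n _ _)
  inSum minus = ≤-trans (inPart minus) (m≤n+m _ _)

colourCountIn≡0 : ∀ A k n c σ i → proj₁ (A σ i) ≢ c → proj₂ (A σ i) ≢ c → colourCountIn A k n c σ i ≡ 0
colourCountIn≡0 A k n c σ i p₁≢c p₂≢c = length-filterᵇ≡0 _ (allEdges (suc (2 * k)) n) λ {e} _ t →
  select≢ (evenᵇ (position (suc (2 * k)) σ i e)) p₁≢c p₂≢c
    (≡ᵇ⇒≡ _ c (proj₂ (∧ᵀ-proj (inGᵇ (suc (2 * k)) σ i e) t)))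

pairColours-used : ∀ A k σ b {i} → 1 ≤ i → i ≤ k → 1 ≤ colourCountIn A k (suc (2 * k)) (select b (A σ i)) σ i
pairColours-used A k σ b {i} 1≤i i≤k with edgeOfParity σ b 1≤i (diagonal-fits i≤k)
... | e , e∈ , inG , refl =
  1≤length-filterᵇ (λ e′ → inGᵇ m σ i e′ ∧ (colourIn A m σ i e′ ≡ᵇ colourIn A m σ i e)) e∈ (inG ∧ᵀ ≡⇒≡ᵇ (colourIn A m σ i e) _ refl)
  where m = suc (2 * k)

_≟ˢ_ : (σ τ : Sign) → Dec (σ ≡ τ)
plus ≟ˢ plus = yes refl
plus ≟ˢ minus = no λ ()
minus ≟ˢ plus = no λ ()
minus ≟ˢ minus = yes refl

signBit : Fin 4 → Sign × Bool
signBit 0F = plus , true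
signBit 1F = plus , false
signBit 2F = minus , true
signBit 3F = minus , false

signBit-injective : Injective _≡_ _≡_ signBit
signBit-injective {q} {r} eq = trans (sym (fromSignBit∘signBit q)) (trans (cong fromSignBit eq) (fromSignBit∘signBit r))
  where
  fromSignBit : Sign × Bool → Fin 4
  fromSignBit (plus , true) = 0F
  fromSignBit (plus , false) = 1F
  fromSignBit (minus , true) = 2F
  fromSignBit (minus , false) = 3F

  fromSignBit∘signBit : ∀ q → fromSignBit (signBit q) ≡ q
  fromSignBit∘signBit 0F = refl
  fromSignBit∘signBit 1F = refl
  fromSignBit∘signBit 2F = refl
  fromSignBit∘signBit 3F = refl

2*[1+x]∸2≡2*x : ∀ x → 2 * suc x ∸ 2 ≡ 2 * x
2*[1+x]∸2≡2*x x = cong (_∸ 1) (+-suc x (x + 0))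

n∸1≢n : ∀ {n} → 1 ≤ n → n ∸ 1 ≢ n
n∸1≢n {suc n} _ = 1+n≢n ∘ sym

module CanonicalColouring (k : ℕ) (1≤k : 1 ≤ k) (A : Assignment) (canonical : CanonicalAssignment k A) where
  open CanonicalAssignment canonical

  m lastColour : ℕ
  m = suc (2 * k)
  lastColour = 2 * m ∸ 2

  lastColour≡4k : lastColour ≡ 4 * k
  lastColour≡4k = trans (2*[1+x]∸2≡2*x (2 * k)) (sym (*-assoc 2 2 k))

  1≤lastColour : 1 ≤ lastColour
  1≤lastColour = subst (1 ≤_) (sym lastColour≡4k) (≤-trans 1≤k (m≤n*m k 4))

  second[G⁻k]≡lastColour : proj₂ (A minus k) ≡ lastColour
  second[G⁻k]≡lastColour = cong proj₂ lastPair

  first[G⁻k]≢lastColour : proj₁ (A minus k) ≢ lastColour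
  first[G⁻k]≢lastColour eq = n∸1≢n 1≤lastColour (trans (∸-+-assoc (2 * m) 2 1) (trans (sym (cong proj₁ lastPair)) eq))

  lastColour-absent : ∀ σ i → 1 ≤ i → i ≤ k → (σ , i) ≢ (minus , k) → colourCountIn A k m lastColour σ i ≡ 0
  lastColour-absent σ i 1≤i i≤k ≢G⁻k = colourCountIn≡0 A k m lastColour σ i
    (λ eq → p₁≢q₂ (trans eq (sym second[G⁻k]≡lastColour)))
    (λ eq → p₂≢q₂ (trans eq (sym second[G⁻k]≡lastColour)))
    where
    apart = disjoint σ minus i k 1≤i i≤k 1≤k ≤-refl ≢G⁻k
    p₁≢q₂ = proj₁ (proj₂ apart)
    p₂≢q₂ = proj₂ (proj₂ (proj₂ apart))

  lastColour⇒odd : ∀ e → colourIn A m minus k e ≡ lastColour → evenᵇ (position m minus k e) ≡ false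
  lastColour⇒odd e eq with evenᵇ (position m minus k e)
  ... | true = ⊥-elim (first[G⁻k]≢lastColour eq)
  ... | false = refl

  lastColour-onceIn-G⁻k : colourCountIn A k m lastColour minus k ≡ 1
  lastColour-onceIn-G⁻k =
    length-filterᵇ≡1 (λ e → inGᵇ m minus k e ∧ (colourIn A m minus k e ≡ᵇ lastColour)) (allEdges-unique m m)
      (shortEdge-∈ minus 1≤k (s≤s z≤n) ≤-refl fits) (inGᵇ-short m minus k (suc k) (suc k) ∧ᵀ ≡⇒≡ᵇ _ lastColour coloured) only
    where
    fits : suc k + k ≤ m
    fits = diagonal-fits {k = k} ≤-refl

    coloured : colourIn A m minus k (edge (suc k) (suc k) k pos) ≡ lastColour
    coloured = let _ , found = leftNeighbour-diagonal minus 1≤k fits in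
      trans (cong (λ p → select (evenᵇ p) (A minus k)) (position≡1 m minus k k pos found)) second[G⁻k]≡lastColour

    only : ∀ {e} → e ∈ allEdges m m → T (inGᵇ m minus k e ∧ (colourIn A m minus k e ≡ᵇ lastColour)) →
           e ≡ edge (suc k) (suc k) k pos
    only {e} e∈ t = let inG , c≡ = ∧ᵀ-proj (inGᵇ m minus k e) t in
      oddEdge-of-G⁻ k e (∈-allEdges⇒validᵇ e∈) inG (lastColour⇒odd e (≡ᵇ⇒≡ _ lastColour c≡))

  lastColour-usedOnce : colourCount A k m lastColour ≡ 1
  lastColour-usedOnce = begin
    colourCount A k m lastColour                            ≡⟨ colourCount-split A k m lastColour ⟩
    sum (map (count plus) (range1 k)) + sum (map (count minus) (range1 k))
      ≡⟨ cong₂ _+_ (sum-map-≡0 (count plus) (range1 k) absentFrom-G⁺)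
                   (sum-map-single (count minus) (range1-unique k) (∈-range1⁺ 1≤k ≤-refl) absentFrom-G⁻) ⟩
    0 + count minus k                                        ≡⟨ lastColour-onceIn-G⁻k ⟩
    1                                                        ∎
    where
    open ≡-Reasoning
    count = colourCountIn A k m lastColour

    absentFrom-G⁺ : ∀ {i} → i ∈ range1 k → count plus i ≡ 0
    absentFrom-G⁺ i∈ = let 1≤i , i≤k = ∈-range1⁻ i∈ in lastColour-absent plus _ 1≤i i≤k λ ()

    absentFrom-G⁻ : ∀ {i} → i ∈ range1 k → i ≢ k → count minus i ≡ 0
    absentFrom-G⁻ i∈ i≢k = let 1≤i , i≤k = ∈-range1⁻ i∈ in lastColour-absent minus _ 1≤i i≤k (i≢k ∘ cong proj₂)

  ValidSlot : (Sign × Bool) × ℕ → Set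
  ValidSlot (_ , i) = 1 ≤ i × i ≤ k

  slotColour : (Sign × Bool) × ℕ → ℕ
  slotColour ((σ , b) , i) = select b (A σ i)

  slotColour-inPalette : ∀ s → ValidSlot s → 1 ≤ slotColour s × slotColour s ≤ lastColour
  slotColour-inPalette ((σ , true) , i) (1≤i , i≤k) = inRange₁ σ i 1≤i i≤k
  slotColour-inPalette ((σ , false) , i) (1≤i , i≤k) = inRange₂ σ i 1≤i i≤k

  slotColour-injective : ∀ {s s′} → ValidSlot s → ValidSlot s′ → slotColour s ≡ slotColour s′ → s ≡ s′
  slotColour-injective {(σ , b) , i} {(τ , b′) , j} (1≤i , i≤k) (1≤j , j≤k) eq with ≡-dec _≟ˢ_ _≟_ (σ , i) (τ , j)
  ... | no different = ⊥-elim (select-disjoint b b′ (disjoint σ τ i j 1≤i i≤k 1≤j j≤k different) eq)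
  ... | yes refl with select-injective (A σ i) (distinctInPair σ i 1≤i i≤k) eq
  ...   | refl = refl

  slotColour-used : ∀ s → ValidSlot s → 1 ≤ colourCount A k m (slotColour s)
  slotColour-used ((σ , b) , i) (1≤i , i≤k) =
    ≤-trans (pairColours-used A k σ b 1≤i i≤k) (colourCountIn≤colourCount A k m (select b (A σ i)) σ 1≤i i≤k)

  slot : Fin (4 * k) → (Sign × Bool) × ℕ
  slot t = signBit (proj₁ (remQuot {4} k t)) , suc (toℕ (proj₂ (remQuot {4} k t)))

  slot-valid : ∀ t → ValidSlot (slot t)
  slot-valid t = s≤s z≤n , Fin.toℕ<n (proj₂ (remQuot {4} k t))

  slot-injective : Injective _≡_ _≡_ slot
  slot-injective {t} {u} eq =
    trans (sym (Fin.combine-remQuot {4} k t))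
      (trans (cong (uncurry combine) (cong₂ _,_ (signBit-injective (cong proj₁ eq)) (Fin.toℕ-injective (suc-injective (cong proj₂ eq)))))
             (Fin.combine-remQuot {4} k u))

  slotColour-covers : ∀ c → 1 ≤ c → c ≤ lastColour → ∃ λ t → slotColour (slot t) ≡ c
  slotColour-covers c 1≤c c≤last =
    injective⇒covers (slotColour ∘ slot) inPalette injective c 1≤c (subst (c ≤_) lastColour≡4k c≤last)
    where
    inPalette : ∀ t → 1 ≤ slotColour (slot t) × slotColour (slot t) ≤ 4 * k
    inPalette t = let lo , hi = slotColour-inPalette (slot t) (slot-valid t)
                  in lo , subst (slotColour (slot t) ≤_) lastColour≡4k hi

    injective : Injective _≡_ _≡_ (slotColour ∘ slot)
    injective {t} {u} = slot-injective ∘ slotColour-injective (slot-valid t) (slot-valid u)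

  everyColour-used : ∀ c → 1 ≤ c → c ≤ lastColour → 1 ≤ colourCount A k m c
  everyColour-used c 1≤c c≤last =
    let t , coloured = slotColour-covers c 1≤c c≤last
    in subst (λ c → 1 ≤ colourCount A k m c) coloured (slotColour-used (slot t) (slot-valid t))

lemma4 : (k : ℕ) → 1 ≤ k → (A : Assignment) → CanonicalAssignment k A →
    (Σ ℕ (λ c → (1 ≤ c) × (c ≤ 2 * suc (2 * k) ∸ 2) × (colourCount A k (suc (2 * k)) c ≡ 1)))
    × ((c : ℕ) → 1 ≤ c → c ≤ 2 * suc (2 * k) ∸ 2 → 1 ≤ colourCount A k (suc (2 * k)) c)
lemma4 k 1≤k A canonical = (lastColour , 1≤lastColour , ≤-refl , lastColour-usedOnce) , everyColour-used
  where open CanonicalColouring k 1≤k A canonical
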